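{- For any connected graph $G$ such that $D(G^c)=2$, $\operatorname{Sd}_s(G,G^c)\ge \max\{\dim_s(G)+\mathring{\beta}(G),\ \beta(G)\}$.
   Context: All graphs are finite, simple and undirected; $G^c$ denotes the complement of $G$ on the same vertex set and $D(H)$ the diameter of a connected graph $H$. For a connected graph $H$, $d_H(x,y)$ is the length of a shortest $x$–$y$ path and $N_H(x)$ the neighbourhood of $x$; a vertex $w$ strongly resolves $u,v$ if $d_H(u,w)=d_H(u,v)+d_H(v,w)$ or $d_H(v,w)=d_H(v,u)+d_H(u,w)$; a set $S\subseteq V(H)$ is a strong metric generator for $H$ if every two distinct vertices are strongly resolved by some vertex of $S$, and $\dim_s(H)$ is the minimum cardinality of such a set. For connected graphs $G_1,\dots,G_k$ on a common vertex set $V$, $\operatorname{Sd}_s(G_1,\dots,G_k)$ is the minimum cardinality of a set $S\subseteq V$ that is a strong metric generator for every $G_i$. $\beta(H)$ is the vertex cover number of $H$. A vertex $u$ is maximally distant from $v$ in $G$ if $d_G(v,w)\le d_G(u,v)$ for every $w\in N_G(u)$; the boundary $\partial(G)$ is the set of vertices that are maximally distant from some vertex of $G$. If $V(G)\ne\partial(G)$, the interior subgraph $\mathring{G}$ is the subgraph of $G$ induced by $V(G)\setminus\partial(G)$. Define $\mathring{\beta}(G)=0$ if $V(G)=\partial(G)$ and $\mathring{\beta}(G)=\beta(\mathring{G})$ otherwise. -}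

module Defs where

open import Data.Nat using (ℕ; zero; suc; _+_; _≤_; _⊔_)
open import Data.Fin using (Fin; _≟_)
open import Data.Fin.Subset using (Subset; _∈_; ∣_∣)
open import Data.Bool using (Bool; true; false; not; _∧_; _∨_; if_then_else_)
open import Data.Bool.Properties using (∧-comm)
open import Data.List using (List; allFin; map; concatMap; foldr)
open import Data.Bool.ListAction using (any)
open import Data.Product using (Σ; ∃; _×_; _,_)
open import Data.Sum using (_⊎_)
open import Relation.Nullary using (¬_; does)
open import Relation.Binary.PropositionalEquality using (_≡_; _≢_; refl; cong₂; sym)

record Graph (n : ℕ) : Set where
  field
    adj    : Fin n → Fin n → Bool
    adj-sym    : ∀ x y → adj x y ≡ adj y x
    adj-irrefl : ∀ x → adj x x ≡ false
open Graph public

private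
  eqb : ∀ {n} → Fin n → Fin n → Bool
  eqb x y = does (x ≟ y)

  eqb-sym : ∀ {n} (x y : Fin n) → eqb x y ≡ eqb y x
  eqb-sym x y with x ≟ y | y ≟ x
  ... | Relation.Nullary.yes _ | Relation.Nullary.yes _ = refl
  ... | Relation.Nullary.no _  | Relation.Nullary.no _  = refl
  ... | Relation.Nullary.yes p | Relation.Nullary.no q  = Data.Empty.⊥-elim (q (sym p))
    where import Data.Empty
  ... | Relation.Nullary.no q  | Relation.Nullary.yes p = Data.Empty.⊥-elim (q (sym p))
    where import Data.Empty

  eqb-refl : ∀ {n} (x : Fin n) → eqb x x ≡ true
  eqb-refl x with x ≟ x
  ... | Relation.Nullary.yes _ = refl
  ... | Relation.Nullary.no q  = Data.Empty.⊥-elim (q refl)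
    where import Data.Empty

complement : ∀ {n} → Graph n → Graph n
adj    (complement G) x y = not (adj G x y) ∧ not (eqb x y)
adj-sym    (complement G) x y = cong₂ (λ a b → not a ∧ not b) (adj-sym G x y) (eqb-sym x y)
adj-irrefl (complement G) x rewrite eqb-refl x = ∧-comm (not (adj G x x)) false

data Walk {n} (G : Graph n) : Fin n → Fin n → ℕ → Set where
  here : ∀ {x} → Walk G x x 0
  step : ∀ {x y z k} → adj G x y ≡ true → Walk G y z k → Walk G x z (suc k)

Connected : ∀ {n} → Graph n → Set
Connected {n} G = ∀ (x y : Fin n) → ∃ λ k → Walk G x y k

reach : ∀ {n} → Graph n → ℕ → Fin n → Fin n → Bool
reach G zero    x y = eqb x y
reach {n} G (suc k) x y =
  reach G k x y ∨ any (λ z → reach G k x z ∧ adj G z y) (allFin n)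

leastFrom : (ℕ → Bool) → ℕ → ℕ → ℕ
leastFrom p start zero       = start
leastFrom p start (suc fuel) = if p start then start else leastFrom p (suc start) fuel

-- d_G(x,y): length of a shortest x–y path (the least k such that
-- y is reachable from x in at most k steps; correct for connected graphs,
-- where d_G(x,y) ≤ n - 1)
dist : ∀ {n} → Graph n → Fin n → Fin n → ℕ
dist {n} G x y = leastFrom (λ k → reach G k x y) 0 n

diam : ∀ {n} → Graph n → ℕ
diam {n} G = foldr _⊔_ 0 (concatMap (λ x → map (dist G x) (allFin n)) (allFin n))

StronglyResolves : ∀ {n} → Graph n → Fin n → Fin n → Fin n → Set
StronglyResolves G w u v =
  (dist G u w ≡ dist G u v + dist G v w) ⊎ (dist G v w ≡ dist G v u + dist G u w)

IsStrongMetricGenerator : ∀ {n} → Graph n → Subset n → Set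
IsStrongMetricGenerator {n} G S =
  ∀ (u v : Fin n) → u ≢ v → ∃ λ w → w ∈ S × StronglyResolves G w u v

IsMinCard : ∀ {n} → (Subset n → Set) → ℕ → Set
IsMinCard {n} P k = (∃ λ (S : Subset n) → P S × ∣ S ∣ ≡ k)
                  × (∀ (S : Subset n) → P S → k ≤ ∣ S ∣)

IsStrongMetricDim : ∀ {n} → Graph n → ℕ → Set
IsStrongMetricDim G k = IsMinCard (IsStrongMetricGenerator G) k

IsSimStrongMetricDim : ∀ {n} → Graph n → Graph n → ℕ → Set
IsSimStrongMetricDim G H k =
  IsMinCard (λ S → IsStrongMetricGenerator G S × IsStrongMetricGenerator H S) k

IsVertexCover : ∀ {n} → Graph n → Subset n → Set
IsVertexCover {n} G C = ∀ (x y : Fin n) → adj G x y ≡ true → x ∈ C ⊎ y ∈ C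

IsVertexCoverNumber : ∀ {n} → Graph n → ℕ → Set
IsVertexCoverNumber G k = IsMinCard (IsVertexCover G) k

MaximallyDistant : ∀ {n} → Graph n → Fin n → Fin n → Set
MaximallyDistant {n} G u v = ∀ (w : Fin n) → adj G u w ≡ true → dist G v w ≤ dist G u v

InBoundary : ∀ {n} → Graph n → Fin n → Set
InBoundary {n} G u = ∃ λ (v : Fin n) → MaximallyDistant G u v

InInterior : ∀ {n} → Graph n → Fin n → Set
InInterior G u = ¬ InBoundary G u

-- C is a vertex cover of the interior subgraph G̊ (the subgraph induced by
-- V(G) \ ∂(G)), viewed as a subset of V(G)
IsInteriorVertexCover : ∀ {n} → Graph n → Subset n → Set
IsInteriorVertexCover {n} G C =
  (∀ (x : Fin n) → x ∈ C → InInterior G x)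
  × (∀ (x y : Fin n) → InInterior G x → InInterior G y → adj G x y ≡ true → x ∈ C ⊎ y ∈ C)

IsInteriorCoverNumber : ∀ {n} → Graph n → ℕ → Set
IsInteriorCoverNumber {n} G k =
  ((∀ (u : Fin n) → InBoundary G u) → k ≡ 0)
  × (¬ (∀ (u : Fin n) → InBoundary G u) → IsMinCard (IsInteriorVertexCover G) k)

{-# OPTIONS --safe #-}
module Submission where

-- Let S be a strong metric generator of both G and Gᶜ. Two vertices adjacent in G are at
-- distance 2 in Gᶜ, and since Gᶜ has diameter 2 the only vertices strongly resolving them
-- there are the two vertices themselves; so S is a vertex cover of G and β(G) ≤ |S|.
-- In G, any pair u ≠ v can be pushed outwards along geodesics to a mutually maximally
-- distant pair x, y. The only strong resolvers of x, y are x and y; both lie in ∂(G) and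
-- both strongly resolve u, v. Hence S ∩ ∂(G) is a strong metric generator of G, the
-- interior vertices of S cover the interior edges, and |S| ≥ dim_s(G) + β̊(G).

open import Defs
open import Data.Bool using (true; false; T; _∧_)
import Data.Bool as Bool
open import Data.Bool.Properties using (T-∨; T-∧; T-≡)
open import Data.Empty using (⊥-elim)
open import Data.Fin using (Fin; zero; suc; toℕ; _≟_)
open import Data.Fin.Properties using (pigeonhole; toℕ≤pred[n]; all?; any?; ¬∀⟶∃¬)
open import Data.Fin.Subset using (Subset; _∈_; _∩_; ∁; ∣_∣; inside; outside)
open import Data.Fin.Subset.Properties using (x∈p∩q⁺; x∈p∩q⁻; x∉p⇒x∈∁p; x∈∁p⇒x∉p)
open import Data.List using (List; _∷_; allFin; foldr; map)
open import Data.List.Membership.Propositional using (lose) renaming (_∈_ to _∈ₗ_)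
open import Data.List.Membership.Propositional.Properties using (∈-allFin; ∈-concatMap⁺; ∈-map⁺)
open import Data.List.Relation.Unary.Any using (here; there; satisfied)
open import Data.List.Relation.Unary.Any.Properties using (any⁺; any⁻)
open import Data.Nat using (ℕ; zero; suc; _+_; _∸_; _≤_; _<_; _⊔_; z≤n; s≤s; _≤?_; _<?_)
open import Data.Nat.Induction using (<-rec)
open import Data.Nat.Properties hiding (_≟_; _≤?_; _<?_)
open import Data.Product using (∃; ∃₂; _×_; _,_; proj₂)
open import Data.Sum using (_⊎_; inj₁; inj₂)
import Data.Sum as Sum
open import Data.Vec using ([]; _∷_; tabulate)
open import Data.Vec.Properties using (lookup⇒[]=; []=⇒lookup; lookup∘tabulate)
open import Function using (_∘_)
open import Function.Bundles using (Equivalence)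
open import Relation.Binary.PropositionalEquality
open import Relation.Nullary using (Dec; does; yes; no; ¬_; contradiction)
open import Relation.Nullary.Decidable using (_→-dec_; dec-true; dec-false; decidable-stable)
open import Relation.Unary using (Pred; Decidable)

module _ {n : ℕ} {G : Graph n} where

  _▷_ : ∀ {x y z k} → Walk G x y k → adj G y z ≡ true → Walk G x z (suc k)
  here ▷ a = step a here
  step b w ▷ a = step b (w ▷ a)

  unsnoc : ∀ {x z k} → Walk G x z (suc k) → ∃ λ y → Walk G x y k × adj G y z ≡ true
  unsnoc {k = zero} (step a here) = _ , here , a
  unsnoc {k = suc k} (step a w) with y , w′ , b ← unsnoc w = y , step a w′ , b

  reverse : ∀ {x y k} → Walk G x y k → Walk G y x k
  reverse here = here
  reverse (step {x} {y} a w) = reverse w ▷ trans (adj-sym G y x) a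

  _++_ : ∀ {x y z j k} → Walk G x y j → Walk G y z k → Walk G x z (j + k)
  here ++ v = v
  step a w ++ v = step a (w ++ v)

  vertexAt : ∀ {x y k} → Walk G x y k → Fin (suc k) → Fin n
  vertexAt {x = x} _ zero = x
  vertexAt (step _ w) (suc i) = vertexAt w i

  take : ∀ {x y k} (w : Walk G x y k) (i : Fin (suc k)) → Walk G x (vertexAt w i) (toℕ i)
  take _ zero = here
  take (step a w) (suc i) = step a (take w i)

  drop : ∀ {x y k} (w : Walk G x y k) (i : Fin (suc k)) → Walk G (vertexAt w i) y (k ∸ toℕ i)
  drop w zero = w
  drop (step a w) (suc i) = drop w i

  shortcut : ∀ {x y k} → Walk G x y k → n < suc k → ∃ λ j → j < k × Walk G x y j
  shortcut {y = y} {k} w n<1+k with i , j , i<j , same ← pigeonhole n<1+k (vertexAt w) =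
    toℕ i + (k ∸ toℕ j) , shorter ,
    take w i ++ subst (λ v → Walk G v y (k ∸ toℕ j)) (sym same) (drop w j)
    where
    shorter : toℕ i + (k ∸ toℕ j) < k
    shorter = begin-strict
      toℕ i + (k ∸ toℕ j) <⟨ +-monoˡ-< (k ∸ toℕ j) i<j ⟩
      toℕ j + (k ∸ toℕ j) ≡⟨ m+[n∸m]≡n (toℕ≤pred[n] j) ⟩
      k                   ∎
      where open ≤-Reasoning

  walk⇒short-walk : ∀ {x y k} → Walk G x y k → ∃ λ j → j < n × Walk G x y j
  walk⇒short-walk {x} {y} {k} = <-rec ShortWalk shorten k
    where
    ShortWalk : ℕ → Set
    ShortWalk k = Walk G x y k → ∃ λ j → j < n × Walk G x y j
    shorten : ∀ k → (∀ {j} → j < k → ShortWalk j) → ShortWalk k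
    shorten k rec w with k <? n
    ... | yes k<n = k , k<n , w
    ... | no k≮n with j , j<k , w′ ← shortcut w (s≤s (≮⇒≥ k≮n)) = rec j<k w′

  walk⇒reach : ∀ {x y k} → Walk G x y k → T (reach G k x y)
  walk⇒reach {x = x} {k = zero} here = Equivalence.from T-≡ (dec-true (x ≟ x) refl)
  walk⇒reach {x} {y} {suc k} w with z , w′ , a ← unsnoc w =
    Equivalence.from T-∨ (inj₂ (any⁺ (λ z → reach G k x z ∧ adj G z y)
      (lose (∈-allFin z) (Equivalence.from T-∧ (walk⇒reach w′ , Equivalence.from T-≡ a)))))

  reach⇒walk : ∀ {x y} k → T (reach G k x y) → ∃ λ j → j ≤ k × Walk G x y j
  reach⇒walk {x} {y} zero r with x ≟ y
  ... | yes refl = 0 , z≤n , here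
  ... | no _ = ⊥-elim r
  reach⇒walk {x} {y} (suc k) r with Equivalence.to T-∨ r
  ... | inj₁ r′ with j , j≤k , w ← reach⇒walk k r′ = j , m≤n⇒m≤1+n j≤k , w
  ... | inj₂ r′ with z , last ← satisfied (any⁻ (λ z → reach G k x z ∧ adj G z y) (allFin n) r′)
              with reach-z , z~y ← Equivalence.to T-∧ last
              with j , j≤k , w ← reach⇒walk k reach-z = suc j , s≤s j≤k , w ▷ Equivalence.to T-≡ z~y

leastFrom-below : ∀ p s f {k} → s ≤ k → k < leastFrom p s f → p k ≡ false
leastFrom-below p s zero s≤k k<s = contradiction s≤k (<⇒≱ k<s)
leastFrom-below p s (suc f) s≤k k<least with p s in ps
... | true = contradiction s≤k (<⇒≱ k<least)
... | false with m≤n⇒m<n∨m≡n s≤k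
...   | inj₁ s<k = leastFrom-below p (suc s) f s<k k<least
...   | inj₂ refl = ps

leastFrom-found : ∀ p s f → leastFrom p s f < s + f → p (leastFrom p s f) ≡ true
leastFrom-found p s zero least<s = contradiction (≤-reflexive (+-identityʳ s)) (<⇒≱ least<s)
leastFrom-found p s (suc f) least<s+f with p s in ps
... | true = ps
... | false = leastFrom-found p (suc s) f (subst (leastFrom p (suc s) f <_) (+-suc s f) least<s+f)

≤foldr-⊔ : ∀ {m} {ms : List ℕ} → m ∈ₗ ms → m ≤ foldr _⊔_ 0 ms
≤foldr-⊔ (here refl) = m≤m⊔n _ _
≤foldr-⊔ {ms = m′ ∷ _} (there m∈ms) = ≤-trans (≤foldr-⊔ m∈ms) (m≤n⊔m m′ _)

dist≤diam : ∀ {n} (G : Graph n) x y → dist G x y ≤ diam G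
dist≤diam {n} G x y = ≤foldr-⊔ (∈-concatMap⁺ (λ x → map (dist G x) (allFin n))
                                  (lose (∈-allFin x) (∈-map⁺ (dist G x) (∈-allFin y))))

module _ {n : ℕ} {G : Graph n} where

  walk⇒dist≤ : ∀ {x y k} → Walk G x y k → dist G x y ≤ k
  walk⇒dist≤ {x} {y} {k} w = ≮⇒≥ λ k<dist →
    subst T (leastFrom-below (λ k → reach G k x y) 0 n z≤n k<dist) (walk⇒reach w)

  dist-refl : ∀ x → dist G x x ≡ 0
  dist-refl x = n≤0⇒n≡0 (walk⇒dist≤ here)

  maximallyDistant? : ∀ u v → Dec (MaximallyDistant G u v)
  maximallyDistant? u v = all? λ w → (adj G u w Bool.≟ true) →-dec (dist G v w ≤? dist G u v)

  inBoundary? : ∀ u → Dec (InBoundary G u)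
  inBoundary? u = any? (maximallyDistant? u)

module Metric {n : ℕ} {G : Graph n} (connected : Connected G) where

  private
    d : Fin n → Fin n → ℕ
    d = dist G

  dist<n : ∀ x y → d x y < n
  dist<n x y with k , k<n , w ← walk⇒short-walk (proj₂ (connected x y)) = ≤-<-trans (walk⇒dist≤ w) k<n

  -- `dist` searches only lengths below n (returning n otherwise), hence dist<n is needed here.
  dist-walk : ∀ x y → Walk G x y (d x y)
  dist-walk x y
    with j , j≤d , w ← reach⇒walk (d x y)
           (Equivalence.from T-≡ (leastFrom-found (λ k → reach G k x y) 0 n (dist<n x y)))
    = subst (Walk G x y) (≤-antisym j≤d (walk⇒dist≤ w)) w

  dist-sym : ∀ x y → d x y ≡ d y x
  dist-sym x y = ≤-antisym (walk⇒dist≤ (reverse (dist-walk y x)))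
                           (walk⇒dist≤ (reverse (dist-walk x y)))

  dist-triangle : ∀ x y z → d x z ≤ d x y + d y z
  dist-triangle x y z = walk⇒dist≤ (dist-walk x y ++ dist-walk y z)

  dist-neighbour : ∀ {x x′} v → adj G x x′ ≡ true → d x′ v ≤ suc (d x v)
  dist-neighbour {x} {x′} v x~x′ = ≤-trans (dist-triangle x′ x v)
    (+-monoˡ-≤ (d x v) (walk⇒dist≤ {G = G} (step (trans (adj-sym G x′ x) x~x′) here)))

  ≢⇒0<dist : ∀ {x y} → x ≢ y → 0 < d x y
  ≢⇒0<dist {x} {y} x≢y with d x y | dist-walk x y
  ... | zero  | here = contradiction refl x≢y
  ... | suc _ | _    = s≤s z≤n

  nonadjacent⇒2≤dist : ∀ {x y} → x ≢ y → adj G x y ≡ false → 2 ≤ d x y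
  nonadjacent⇒2≤dist {x} {y} x≢y x≁y with d x y | dist-walk x y
  ... | zero        | here             = contradiction refl x≢y
  ... | suc zero    | step x~y here    = contradiction (trans (sym x~y) x≁y) λ ()
  ... | suc (suc _) | _                = s≤s (s≤s z≤n)

  Between : Fin n → Fin n → Fin n → Set
  Between a v b = d a b ≡ d a v + d v b

  between-start : ∀ a b → Between a a b
  between-start a b = cong (_+ d a b) (sym (dist-refl a))

  between-sym : ∀ {a v b} → Between a v b → Between b v a
  between-sym {a} {v} {b} avb = begin
    d b a         ≡⟨ dist-sym b a ⟩
    d a b         ≡⟨ avb ⟩
    d a v + d v b ≡⟨ +-comm (d a v) (d v b) ⟩
    d v b + d a v ≡⟨ cong₂ _+_ (dist-sym v b) (dist-sym a v) ⟩
    d b v + d v a ∎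
    where open ≡-Reasoning

  between-≤ : ∀ {a v b} → Between a v b → d v b ≤ d a b
  between-≤ {a} {v} {b} avb = ≤-trans (m≤n+m (d v b) (d a v)) (≤-reflexive (sym avb))

  between-trans : ∀ {x u v y} → Between x u v → Between x v y → Between u v y
  between-trans {x} {u} {v} {y} xuv xvy =
    ≤-antisym (dist-triangle u v y) (+-cancelˡ-≤ (d x u) _ _ (begin
      d x u + (d u v + d v y) ≡⟨ +-assoc (d x u) (d u v) (d v y) ⟨
      d x u + d u v + d v y   ≡⟨ cong (_+ d v y) xuv ⟨
      d x v + d v y           ≡⟨ xvy ⟨
      d x y                   ≤⟨ dist-triangle x u y ⟩
      d x u + d u y           ∎))
    where open ≤-Reasoning

  farther-neighbour : ∀ {x t} → ¬ MaximallyDistant G x t →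
                      ∃ λ x′ → adj G x x′ ≡ true × d x′ t ≡ suc (d x t)
  farther-neighbour {x} {t} ¬md
    with x′ , ¬bounded ← ¬∀⟶∃¬ n _ (λ w → (adj G x w Bool.≟ true) →-dec (d t w ≤? d x t)) ¬md
    with adj G x x′ Bool.≟ true | d t x′ ≤? d x t
  ... | no x≁x′  | _        = contradiction (λ x~x′ → contradiction x~x′ x≁x′) ¬bounded
  ... | yes _    | yes near = contradiction (λ _ → near) ¬bounded
  ... | yes x~x′ | no far   = x′ , x~x′ , ≤-antisym (dist-neighbour t x~x′)
                                            (subst (d x t <_) (dist-sym t x′) (≰⇒> far))

  maximallyDistant-along : ∀ {x v y} → Between y v x → MaximallyDistant G x v →
                           MaximallyDistant G x y
  maximallyDistant-along {x} {v} {y} yvx x⋯v x′ x~x′ = begin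
    d y x′         ≤⟨ dist-triangle y v x′ ⟩
    d y v + d v x′ ≤⟨ +-monoʳ-≤ (d y v) (x⋯v x′ x~x′) ⟩
    d y v + d x v  ≡⟨ cong (d y v +_) (dist-sym x v) ⟩
    d y v + d v x  ≡⟨ yvx ⟨
    d y x          ≡⟨ dist-sym y x ⟩
    d x y          ∎
    where open ≤-Reasoning

  geodesic-to-maximallyDistant : ∀ a t → ∃ λ x → Between x a t × MaximallyDistant G x t
  geodesic-to-maximallyDistant a t = climb n a (m≤m+n n (d a t)) (between-start a t)
    where
    climb : ∀ fuel x → n ≤ fuel + d x t → Between x a t →
            ∃ λ x → Between x a t × MaximallyDistant G x t
    climb zero x bound _ = contradiction bound (<⇒≱ (dist<n x t))
    climb (suc fuel) x bound xat with maximallyDistant? x t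
    ... | yes x⋯t = x , xat , x⋯t
    ... | no ¬x⋯t with x′ , x~x′ , x′t ← farther-neighbour ¬x⋯t = climb fuel x′ bound′ x′at
      where
      bound′ : n ≤ fuel + d x′ t
      bound′ = ≤-trans bound (≤-reflexive (trans (sym (+-suc fuel (d x t))) (cong (fuel +_) (sym x′t))))
      x′at : Between x′ a t
      x′at = ≤-antisym (dist-triangle x′ a t) (begin
        d x′ a + d a t      ≤⟨ +-monoˡ-≤ (d a t) (dist-neighbour a x~x′) ⟩
        suc (d x a + d a t) ≡⟨ cong suc xat ⟨
        suc (d x t)         ≡⟨ x′t ⟨
        d x′ t              ∎)
        where open ≤-Reasoning

  beyond-maximallyDistant : ∀ {x y w} → MaximallyDistant G y x → Between x y w → w ≡ y
  beyond-maximallyDistant {x} {y} {w} y⋯x = walk-from-end (dist-walk y w)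
    where
    walk-from-end : ∀ {k} → Walk G y w k → d x w ≡ d x y + k → w ≡ y
    walk-from-end here _ = refl
    walk-from-end {suc k} (step {y = y′} y~y′ rest) xyw = contradiction (begin
      d x y + suc k   ≡⟨ xyw ⟨
      d x w           ≤⟨ dist-triangle x y′ w ⟩
      d x y′ + d y′ w ≤⟨ +-mono-≤ (≤-trans (y⋯x y′ y~y′) (≤-reflexive (dist-sym y x)))
                                  (walk⇒dist≤ rest) ⟩
      d x y + k       ∎) (<⇒≱ (+-monoʳ-< (d x y) (n<1+n k)))
      where open ≤-Reasoning

  resolving-mutuallyMaximallyDistant : ∀ {x y w} → MaximallyDistant G x y → MaximallyDistant G y x →
                                       StronglyResolves G w x y → w ≡ y ⊎ w ≡ x
  resolving-mutuallyMaximallyDistant x⋯y y⋯x =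
    Sum.map (beyond-maximallyDistant y⋯x) (beyond-maximallyDistant x⋯y)

  boundary-resolves : ∀ {u v} → u ≢ v → ∃₂ λ x y → x ≢ y ×
                      (∀ w → StronglyResolves G w x y → InBoundary G w × StronglyResolves G w u v)
  boundary-resolves {u} {v} u≢v
    with x , xuv , x⋯v ← geodesic-to-maximallyDistant u v
    with y , yvx , y⋯x ← geodesic-to-maximallyDistant v x
    = x , y , x≢y , resolver
    where
    x⋯y : MaximallyDistant G x y
    x⋯y = maximallyDistant-along yvx x⋯v
    x≢y : x ≢ y
    x≢y refl = contradiction (begin
      d u v ≤⟨ between-≤ xuv ⟩
      d x v ≡⟨ dist-sym x v ⟩
      d v x ≤⟨ between-≤ yvx ⟩
      d x x ≡⟨ dist-refl x ⟩
      0     ∎) (<⇒≱ (≢⇒0<dist u≢v))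
      where open ≤-Reasoning
    resolver : ∀ w → StronglyResolves G w x y → InBoundary G w × StronglyResolves G w u v
    resolver w w-res with resolving-mutuallyMaximallyDistant x⋯y y⋯x w-res
    ... | inj₁ refl = (x , y⋯x) , inj₁ (between-trans xuv (between-sym yvx))
    ... | inj₂ refl = (y , x⋯y) , inj₂ (between-sym xuv)

  beyond-nonadjacent : diam G ≤ 2 → ∀ {x y w} → x ≢ y → adj G x y ≡ false → Between x y w → w ≡ y
  beyond-nonadjacent diam≤2 {x} {y} {w} x≢y x≁y xyw with w ≟ y
  ... | yes w≡y = w≡y
  ... | no w≢y = ⊥-elim (<-irrefl refl (begin-strict
    2             <⟨ +-mono-≤ (nonadjacent⇒2≤dist x≢y x≁y) (≢⇒0<dist (w≢y ∘ sym)) ⟩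
    d x y + d y w ≡⟨ xyw ⟨
    d x w         ≤⟨ dist≤diam G x w ⟩
    diam G        ≤⟨ diam≤2 ⟩
    2             ∎))
    where open ≤-Reasoning

  resolving-nonadjacent : diam G ≤ 2 → ∀ {x y w} → x ≢ y → adj G x y ≡ false →
                          StronglyResolves G w x y → w ≡ y ⊎ w ≡ x
  resolving-nonadjacent diam≤2 {x} {y} x≢y x≁y =
    Sum.map (beyond-nonadjacent diam≤2 x≢y x≁y)
            (beyond-nonadjacent diam≤2 (x≢y ∘ sym) (trans (adj-sym G y x) x≁y))

select : ∀ {n p} {P : Pred (Fin n) p} → Decidable P → Subset n
select P? = tabulate (does ∘ P?)

module _ {n p} {P : Pred (Fin n) p} (P? : Decidable P) where

  ∈-select⁺ : ∀ {x} → P x → x ∈ select P?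
  ∈-select⁺ {x} px = lookup⇒[]= x _ (trans (lookup∘tabulate (does ∘ P?) x) (dec-true (P? x) px))

  ∈-select⁻ : ∀ {x} → x ∈ select P? → P x
  ∈-select⁻ {x} x∈P = decidable-stable (P? x) λ ¬px →
    contradiction (trans (sym (dec-false (P? x) ¬px)) selected) λ ()
    where
    selected : does (P? x) ≡ true
    selected = trans (sym (lookup∘tabulate (does ∘ P?) x)) ([]=⇒lookup x∈P)

∣p∩q∣+∣p∩∁q∣≡∣p∣ : ∀ {n} (p q : Subset n) → ∣ p ∩ q ∣ + ∣ p ∩ ∁ q ∣ ≡ ∣ p ∣
∣p∩q∣+∣p∩∁q∣≡∣p∣ [] [] = refl
∣p∩q∣+∣p∩∁q∣≡∣p∣ (outside ∷ p) (_ ∷ q) = ∣p∩q∣+∣p∩∁q∣≡∣p∣ p q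
∣p∩q∣+∣p∩∁q∣≡∣p∣ (inside ∷ p) (inside ∷ q) = cong suc (∣p∩q∣+∣p∩∁q∣≡∣p∣ p q)
∣p∩q∣+∣p∩∁q∣≡∣p∣ (inside ∷ p) (outside ∷ q) = trans (+-suc _ _) (cong suc (∣p∩q∣+∣p∩∁q∣≡∣p∣ p q))

module _ {n : ℕ} {G : Graph n} where

  ∂ : Subset n
  ∂ = select (inBoundary? {G = G})

  interior⇒∈∁∂ : ∀ {x} → InInterior G x → x ∈ ∁ ∂
  interior⇒∈∁∂ x° = x∉p⇒x∈∁p (x° ∘ ∈-select⁻ inBoundary?)

  ∈∁∂⇒interior : ∀ {x} → x ∈ ∁ ∂ → InInterior G x
  ∈∁∂⇒interior x∈∁∂ = x∈∁p⇒x∉p x∈∁∂ ∘ ∈-select⁺ inBoundary?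

  generator-∩∂ : Connected G → ∀ {S} → IsStrongMetricGenerator G S → IsStrongMetricGenerator G (S ∩ ∂)
  generator-∩∂ connected generates u v u≢v
    with x , y , x≢y , resolver ← Metric.boundary-resolves connected u≢v
    with w , w∈S , w-res-xy ← generates x y x≢y
    with w∈∂ , w-res-uv ← resolver w w-res-xy
    = w , x∈p∩q⁺ (w∈S , ∈-select⁺ inBoundary? w∈∂) , w-res-uv

  vertexCover-∩∁∂ : ∀ {S} → IsVertexCover G S → IsInteriorVertexCover G (S ∩ ∁ ∂)
  vertexCover-∩∁∂ {S} covers =
      (λ x x∈ → ∈∁∂⇒interior (proj₂ (x∈p∩q⁻ S (∁ ∂) x∈)))
    , λ x y x° y° x~y → Sum.map (λ x∈S → x∈p∩q⁺ (x∈S , interior⇒∈∁∂ x°))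
                                (λ y∈S → x∈p∩q⁺ (y∈S , interior⇒∈∁∂ y°)) (covers x y x~y)

  interiorCoverNumber≤ : ∀ {k C} → IsInteriorCoverNumber G k → IsInteriorVertexCover G C → k ≤ ∣ C ∣
  interiorCoverNumber≤ (all-boundary , some-interior) covers with all? (inBoundary? {G = G})
  ... | yes all∂ rewrite all-boundary all∂ = z≤n
  ... | no ¬all∂ = proj₂ (some-interior ¬all∂) _ covers

  adj⇒≢ : ∀ {x y} → adj G x y ≡ true → x ≢ y
  adj⇒≢ {x} x~y refl = contradiction (trans (sym x~y) (adj-irrefl G x)) λ ()

  adj⇒complement-nonadjacent : ∀ {x y} → adj G x y ≡ true → adj (complement G) x y ≡ false
  adj⇒complement-nonadjacent x~y rewrite x~y = refl

  complement-generator⇒vertexCover : Connected (complement G) → diam (complement G) ≤ 2 →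
    ∀ {S} → IsStrongMetricGenerator (complement G) S → IsVertexCover G S
  complement-generator⇒vertexCover connected diam≤2 generates x y x~y
    with w , w∈S , w-res ← generates x y (adj⇒≢ x~y)
    with Metric.resolving-nonadjacent connected diam≤2 (adj⇒≢ x~y) (adj⇒complement-nonadjacent x~y) w-res
  ... | inj₁ refl = inj₂ w∈S
  ... | inj₂ refl = inj₁ w∈S

mainTheorem16 : ∀ {n} (G : Graph n) → Connected G → Connected (complement G)
                → diam (complement G) ≡ 2
                → ∀ (sd ds bi b : ℕ)
                → IsSimStrongMetricDim G (complement G) sd
                → IsStrongMetricDim G ds
                → IsInteriorCoverNumber G bi
                → IsVertexCoverNumber G b
                → (ds + bi) ⊔ b ≤ sd
mainTheorem16 G connected connectedᶜ diam≡2 sd ds bi b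
  ((S , (generates , generatesᶜ) , ∣S∣≡sd) , _) (_ , dim-minimal) interior (_ , β-minimal) =
  ⊔-lub (begin
    ds + bi                 ≤⟨ +-mono-≤ (dim-minimal _ (generator-∩∂ connected generates))
                                        (interiorCoverNumber≤ interior (vertexCover-∩∁∂ covers)) ⟩
    ∣ S ∩ ∂ ∣ + ∣ S ∩ ∁ ∂ ∣ ≡⟨ ∣p∩q∣+∣p∩∁q∣≡∣p∣ S ∂ ⟩
    ∣ S ∣                   ≡⟨ ∣S∣≡sd ⟩
    sd                      ∎)
    (subst (b ≤_) ∣S∣≡sd (β-minimal S covers))
  where
  open ≤-Reasoning
  covers : IsVertexCover G S
  covers = complement-generator⇒vertexCover connectedᶜ (≤-reflexive diam≡2) generatesᶜ
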